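{- Let $A\in E^{[\infty]}$ and $Y\subseteq E$. Then $\langle A\rangle\cap\langle Y\rangle$ is small if and only if $\langle A/N\rangle\cap\langle Y\rangle\subseteq\{0\}$ for some $N$. Consequently: (1) for $A,B\in E^{[\infty]}$, $A$ and $B$ are almost disjoint iff $\langle A/N\rangle\cap\langle B\rangle\subseteq\{0\}$ for some $N$; (2) if $A/N$ and $B$ are almost disjoint for some $N$, then $A$ and $B$ are almost disjoint.
   Context: $E$ is a vector space over a countable field $\mathbb{F}$ with countable Hamel basis $(e_n)_{n<\omega}$. For $x=\sum_n\lambda_ne_n$, $\mathrm{supp}(x)=\{n:\lambda_n\ne0\}$; for nonzero $x,y$, $x<y$ iff $\max\mathrm{supp}(x)<\min\mathrm{supp}(y)$. A block sequence is a $<$-increasing sequence of nonzero vectors; $E^{[\infty]}$ is the set of infinite ones; $\langle A\rangle$ is the span of the terms of $A$; $\langle Y\rangle=\mathrm{span}(Y)$; $A/N$ is $A$ with its first $N$ terms removed. $A,B\in E^{[\infty]}$ are almost disjoint if $\langle A\rangle\cap\langle B\rangle$ is finite-dimensional. A set $Z\subseteq E$ is big if $\langle C\rangle\subseteq Z$ for some $C\in E^{[\infty]}$, small otherwise. -}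

module Defs where

open import Level using (0ℓ)
open import Data.Nat using (ℕ; _<_; _≤_; _⊔_)
import Data.Nat as ℕ
open import Data.Nat.Properties using (m≤n⇒m≤n⊔o; m≤n⇒m≤o⊔n; ≤-trans; ≤-refl)
open import Data.Product using (Σ; ∃; _×_; _,_; proj₁; proj₂)
open import Data.List using (List; []; _∷_)
open import Data.List.Relation.Unary.All using (All)
open import Data.List.Membership.Propositional using (_∈_)
open import Relation.Nullary using (¬_)
open import Relation.Binary.PropositionalEquality using (_≡_)
open import Algebra.Bundles using (CommutativeRing)

record Field : Set₁ where
  field
    commRing : CommutativeRing 0ℓ 0ℓ
  open CommutativeRing commRing public
  field
    1≉0     : ¬ (1# ≈ 0#)
    inverse : ∀ x → ¬ (x ≈ 0#) → ∃ λ y → x * y ≈ 1#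

Countable : Field → Set
Countable F = ∃ λ (f : Carrier → ℕ) → ∀ x y → f x ≡ f y → x ≈ y
  where open Field F

-- The vector space E over F with Hamel basis (e_n), realised concretely as
-- finitely supported sequences of coefficients: x = Σ_n coeff x n · e_n.
module VS (F : Field) where
  open Field F

  record E : Set where
    field
      coeff  : ℕ → Carrier
      bound  : ℕ
      vanish : ∀ n → bound ≤ n → coeff n ≈ 0#
  open E public

  _≈E_ : E → E → Set
  x ≈E y = ∀ n → coeff x n ≈ coeff y n

  0E : E
  0E = record { coeff = λ _ → 0# ; bound = 0 ; vanish = λ _ _ → refl }

  _+E_ : E → E → E
  x +E y = record
    { coeff  = λ n → coeff x n + coeff y n
    ; bound  = bound x ⊔ bound y
    ; vanish = λ n b≤n →
        trans (+-cong (vanish x n (≤-trans (m≤n⇒m≤n⊔o (bound y) ≤-refl) b≤n))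
                      (vanish y n (≤-trans (m≤n⇒m≤o⊔n (bound x) ≤-refl) b≤n)))
              (+-identityˡ 0#)
    }

  _·E_ : Carrier → E → E
  c ·E x = record
    { coeff  = λ n → c * coeff x n
    ; bound  = bound x
    ; vanish = λ n b≤n → trans (*-congˡ (vanish x n b≤n)) (zeroʳ c)
    }

  lincomb : List (Carrier × E) → E
  lincomb []            = 0E
  lincomb ((c , v) ∷ L) = (c ·E v) +E lincomb L

  ⟨_⟩ : (E → Set) → E → Set
  ⟨ Y ⟩ v = ∃ λ (L : List (Carrier × E)) → All (λ p → Y (proj₂ p)) L × (v ≈E lincomb L)

  Seq : Set
  Seq = ℕ → E

  Terms : Seq → E → Set
  Terms A w = ∃ λ i → w ≡ A i

  ⟨_⟩ˢ : Seq → E → Set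
  ⟨ A ⟩ˢ = ⟨ Terms A ⟩

  _/_ : Seq → ℕ → Seq
  (A / N) i = A (N ℕ.+ i)

  NonZero : E → Set
  NonZero x = ¬ (x ≈E 0E)

  -- x < y  iff  max supp x < min supp y; written out as: there is m with
  -- supp x ⊆ [0,m) and supp y ⊆ [m,∞)   (equivalent for nonzero x, y).
  _<ᵇ_ : E → E → Set
  x <ᵇ y = ∃ λ m → (∀ n → ¬ (coeff x n ≈ 0#) → n < m)
                 × (∀ n → ¬ (coeff y n ≈ 0#) → m ≤ n)

  BlockSeq : Seq → Set
  BlockSeq A = (∀ i → NonZero (A i)) × (∀ i j → i < j → A i <ᵇ A j)

  _∩_ : (E → Set) → (E → Set) → E → Set
  (Z ∩ W) v = Z v × W v

  _⊆_ : (E → Set) → (E → Set) → Set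
  Z ⊆ W = ∀ v → Z v → W v

  Zero : E → Set
  Zero v = v ≈E 0E

  Big : (E → Set) → Set
  Big Z = ∃ λ C → BlockSeq C × (⟨ C ⟩ˢ ⊆ Z)

  Small : (E → Set) → Set
  Small Z = ¬ Big Z

  FinDim : (E → Set) → Set
  FinDim Z = ∃ λ (L : List E) → All Z L × (Z ⊆ ⟨ (λ w → w ∈ L) ⟩)

  AlmostDisjoint : Seq → Seq → Set
  AlmostDisjoint A B = FinDim (⟨ A ⟩ˢ ∩ ⟨ B ⟩ˢ)

{-# OPTIONS --safe #-}
module Submission where

-- The support geometry of a block sequence A does all the work. Its k-th term is
-- supported in [k, ∞), and for every N some threshold t has A₀ … A_{N-1} supported
-- below t and A/N supported from t; hence a vector of ⟨A⟩ supported from t already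
-- lies in ⟨A/N⟩. So if ⟨A/N⟩ ∩ Z = 0, the only vector of ⟨A⟩ ∩ Z supported from t
-- is 0: no block sequence fits in ⟨A⟩ ∩ Z (its t-th term would be such a vector),
-- and eliminating the coordinates below t one at a time shows ⟨A⟩ ∩ Z is
-- finite-dimensional. Conversely, a finite-dimensional ⟨A⟩ ∩ Z is supported below
-- some b and so misses ⟨A/b⟩, and if every tail meets Z nontrivially, nonzero
-- vectors picked from tails beyond the supports of the previous picks form a block
-- sequence inside ⟨A⟩ ∩ Z.

open import Defs
open import Level using (0ℓ)
open import Data.Nat using (ℕ)
open import Data.Product using (∃; _×_)
open import Function.Bundles using (_⇔_)
open import Axiom.ExcludedMiddle using (ExcludedMiddle)

open import Data.Nat using (zero; suc; _≤_; _<_; _≤′_; ≤′-refl; ≤′-step; _⊔_; _∸_; _<?_)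
import Data.Nat as ℕ
import Data.Nat.Properties as ℕₚ
open import Data.Product using (∃₂; _,_; proj₁; proj₂)
open import Data.Sum using (inj₁; inj₂)
open import Data.List using (List; []; _∷_; _++_)
open import Data.List.Relation.Unary.All as All using (All; []; _∷_)
open import Data.List.Relation.Unary.All.Properties using (++⁺)
open import Data.List.Relation.Unary.Any using (here; there)
open import Data.List.Membership.Propositional using (_∈_)
open import Relation.Nullary using (¬_; yes; no)
open import Relation.Binary.PropositionalEquality as ≡ using (_≡_)
open import Function.Bundles using (mk⇔)
open import Axiom.DoubleNegationElimination using (em⇒dne)

stepwise-mono : (T : ℕ → ℕ) → (∀ k → T k ≤ T (suc k)) → ∀ {i j} → i ≤′ j → T i ≤ T j
stepwise-mono T step ≤′-refl     = ℕₚ.≤-refl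
stepwise-mono T step (≤′-step p) = ℕₚ.≤-trans (stepwise-mono T step p) (step _)

module BlockSequences (F : Field) where
  open Field F
  open VS F
  open import Algebra.Properties.CommutativeSemigroup +-commutativeSemigroup using (interchange)
  open import Algebra.Properties.Ring ring using (-‿distribˡ-*)
  open import Relation.Binary.Reasoning.Setoid setoid

  private variable
    Y Y′ Z W : E → Set
    z w : E
    ps : List (Carrier × E)
    M m m′ s t : ℕ

  record IsSubspace (Z : E → Set) : Set where
    field
      ≈E-resp   : ∀ {x y} → x ≈E y → Z x → Z y
      0E∈       : Z 0E
      +E-closed : ∀ {x y} → Z x → Z y → Z (x +E y)
      ·E-closed : ∀ c {x} → Z x → Z (c ·E x)
  open IsSubspace

  ∩-isSubspace : IsSubspace Z → IsSubspace W → IsSubspace (Z ∩ W)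
  ∩-isSubspace S T = record
    { ≈E-resp   = λ x≈y (z , w) → ≈E-resp S x≈y z , ≈E-resp T x≈y w
    ; 0E∈       = 0E∈ S , 0E∈ T
    ; +E-closed = λ (z , w) (z′ , w′) → +E-closed S z z′ , +E-closed T w w′
    ; ·E-closed = λ c (z , w) → ·E-closed S c z , ·E-closed T c w
    }

  _+ˢ_ : (E → Set) → (E → Set) → E → Set
  (Z +ˢ W) v = ∃₂ λ z w → Z z × W w × v ≈E (z +E w)

  +ˢ-isSubspace : IsSubspace Z → IsSubspace W → IsSubspace (Z +ˢ W)
  +ˢ-isSubspace S T = record
    { ≈E-resp   = λ x≈y (z , w , z∈ , w∈ , x≈) → z , w , z∈ , w∈ , λ n → trans (sym (x≈y n)) (x≈ n)
    ; 0E∈       = 0E , 0E , 0E∈ S , 0E∈ T , λ _ → sym (+-identityˡ 0#)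
    ; +E-closed = λ (z , w , z∈ , w∈ , x≈) (z′ , w′ , z′∈ , w′∈ , y≈) →
        z +E z′ , w +E w′ , +E-closed S z∈ z′∈ , +E-closed T w∈ w′∈ ,
        λ n → trans (+-cong (x≈ n) (y≈ n)) (interchange _ _ _ _)
    ; ·E-closed = λ c (z , w , z∈ , w∈ , x≈) →
        c ·E z , c ·E w , ·E-closed S c z∈ , ·E-closed T c w∈ ,
        λ n → trans (*-congˡ (x≈ n)) (distribˡ c _ _)
    }

  lincomb-closed : IsSubspace Z → All (λ p → Z (proj₂ p)) ps → Z (lincomb ps)
  lincomb-closed S []         = 0E∈ S
  lincomb-closed S (z∈ ∷ z∈s) = +E-closed S (·E-closed S _ z∈) (lincomb-closed S z∈s)

  span-least : IsSubspace Z → Y ⊆ Z → ⟨ Y ⟩ ⊆ Z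
  span-least S Y⊆Z v (L , L⊆Y , v≈) =
    ≈E-resp S (λ n → sym (v≈ n)) (lincomb-closed S (All.map (λ {p} → Y⊆Z (proj₂ p)) L⊆Y))

  span-mono : Y ⊆ Y′ → ⟨ Y ⟩ ⊆ ⟨ Y′ ⟩
  span-mono Y⊆Y′ v (L , L⊆Y , v≈) = L , All.map (λ {p} → Y⊆Y′ (proj₂ p)) L⊆Y , v≈

  ⊆-span : Y ⊆ ⟨ Y ⟩
  ⊆-span y y∈Y = (1# , y) ∷ [] , y∈Y ∷ [] , λ n → sym (trans (+-identityʳ _) (*-identityˡ _))

  lincomb-++ : ∀ L L′ n → coeff (lincomb (L ++ L′)) n ≈ coeff (lincomb L) n + coeff (lincomb L′) n
  lincomb-++ []      L′ n = sym (+-identityˡ _)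
  lincomb-++ (_ ∷ L) L′ n = trans (+-congˡ (lincomb-++ L L′ n)) (sym (+-assoc _ _ _))

  scaleCoeffs : Carrier → List (Carrier × E) → List (Carrier × E)
  scaleCoeffs c []            = []
  scaleCoeffs c ((d , v) ∷ L) = (c * d , v) ∷ scaleCoeffs c L

  scaleCoeffs-all : ∀ c → All (λ p → Y (proj₂ p)) ps → All (λ p → Y (proj₂ p)) (scaleCoeffs c ps)
  scaleCoeffs-all c []         = []
  scaleCoeffs-all c (y∈ ∷ y∈s) = y∈ ∷ scaleCoeffs-all c y∈s

  lincomb-scaleCoeffs : ∀ c L n → coeff (lincomb (scaleCoeffs c L)) n ≈ c * coeff (lincomb L) n
  lincomb-scaleCoeffs c []            n = sym (zeroʳ c)
  lincomb-scaleCoeffs c ((d , v) ∷ L) n =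
    trans (+-cong (*-assoc c d _) (lincomb-scaleCoeffs c L n)) (sym (distribˡ c _ _))

  span-isSubspace : ∀ Y → IsSubspace ⟨ Y ⟩
  span-isSubspace Y = record
    { ≈E-resp   = λ x≈y (L , L⊆ , x≈) → L , L⊆ , λ n → trans (sym (x≈y n)) (x≈ n)
    ; 0E∈       = [] , [] , λ _ → refl
    ; +E-closed = λ (L , L⊆ , x≈) (L′ , L′⊆ , y≈) →
        L ++ L′ , ++⁺ L⊆ L′⊆ , λ n → trans (+-cong (x≈ n) (y≈ n)) (sym (lincomb-++ L L′ n))
    ; ·E-closed = λ c (L , L⊆ , x≈) →
        scaleCoeffs c L , scaleCoeffs-all c L⊆ ,
        λ n → trans (*-congˡ (x≈ n)) (sym (lincomb-scaleCoeffs c L n))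
    }

  tail-span⊆span : ∀ A M → ⟨ A / M ⟩ˢ ⊆ ⟨ A ⟩ˢ
  tail-span⊆span A M = span-mono (λ w (i , w≡) → M ℕ.+ i , w≡)

  tail-span⊆tail-tail-span : ∀ A M K → ⟨ A / (M ℕ.+ K) ⟩ˢ ⊆ ⟨ (A / M) / K ⟩ˢ
  tail-span⊆tail-tail-span A M K =
    span-mono (λ w (i , w≡) → i , ≡.trans w≡ (≡.cong A (ℕₚ.+-assoc M K i)))

  blockSeq-tail : ∀ A M → BlockSeq A → BlockSeq (A / M)
  blockSeq-tail A M (nonZero , ordered) =
    (λ i → nonZero (M ℕ.+ i)) , λ i j i<j → ordered _ _ (ℕₚ.+-monoʳ-< M i<j)

  VanishOn : (ℕ → Set) → E → Set
  VanishOn P x = ∀ n → P n → coeff x n ≈ 0#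

  vanishOn-isSubspace : ∀ P → IsSubspace (VanishOn P)
  vanishOn-isSubspace P = record
    { ≈E-resp   = λ x≈y x₀ n Pn → trans (sym (x≈y n)) (x₀ n Pn)
    ; 0E∈       = λ _ _ → refl
    ; +E-closed = λ x₀ y₀ n Pn → trans (+-cong (x₀ n Pn) (y₀ n Pn)) (+-identityʳ 0#)
    ; ·E-closed = λ c x₀ n Pn → trans (*-congˡ (x₀ n Pn)) (zeroʳ c)
    }

  vanishOn-anti : ∀ {P Q : ℕ → Set} → (∀ {n} → Q n → P n) → VanishOn P ⊆ VanishOn Q
  vanishOn-anti Q⇒P x x₀ n Qn = x₀ n (Q⇒P Qn)

  SupportedBelow SupportedFrom VanishesAt : ℕ → E → Set
  SupportedBelow t = VanishOn (t ≤_)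
  SupportedFrom  t = VanishOn (_< t)
  VanishesAt     s = VanishOn (_≡ s)

  supportedBelow∩supportedFrom⊆zero : (SupportedBelow t ∩ SupportedFrom t) ⊆ Zero
  supportedBelow∩supportedFrom⊆zero {t} x (below , from) n with n <? t
  ... | yes n<t = from n n<t
  ... | no  n≮t = below n (ℕₚ.≮⇒≥ n≮t)

  supportedFrom-suc : ∀ x → SupportedFrom s x → VanishesAt s x → SupportedFrom (suc s) x
  supportedFrom-suc _ from xₛ≈0 n n<1+s with ℕₚ.m<1+n⇒m<n∨m≡n n<1+s
  ... | inj₁ n<s = from n n<s
  ... | inj₂ n≡s = xₛ≈0 n n≡s

  separated⇒<ᵇ : ∀ x y → SupportedBelow m x → SupportedFrom m y → x <ᵇ y
  separated⇒<ᵇ {m} _ _ below from =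
    m , (λ n xₙ≉0 → ℕₚ.≰⇒> (λ m≤n → xₙ≉0 (below n m≤n)))
      , (λ n yₙ≉0 → ℕₚ.≮⇒≥ (λ n<m → yₙ≉0 (from n n<m)))

  nonZero-supports⇒< : ∀ x → NonZero x → SupportedFrom m x → SupportedBelow m′ x → m < m′
  nonZero-supports⇒< x x≉0 from below = ℕₚ.≰⇒> λ m′≤m →
    x≉0 (supportedBelow∩supportedFrom⊆zero x (vanishOn-anti (ℕₚ.≤-trans m′≤m) x below , from))

  maxBound : List E → ℕ
  maxBound []      = 0
  maxBound (w ∷ ws) = bound w ⊔ maxBound ws

  ∈⇒supportedBelow-maxBound : ∀ {ws} → w ∈ ws → SupportedBelow (maxBound ws) w
  ∈⇒supportedBelow-maxBound {w} (here ≡.refl) =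
    vanishOn-anti (ℕₚ.≤-trans (ℕₚ.m≤m⊔n _ _)) w (vanish w)
  ∈⇒supportedBelow-maxBound {w} {u ∷ _} (there w∈ws) =
    vanishOn-anti (ℕₚ.≤-trans (ℕₚ.m≤n⊔m (bound u) _)) w (∈⇒supportedBelow-maxBound w∈ws)

  finDim⇒supportedBelow : FinDim Z → ∃ λ b → Z ⊆ SupportedBelow b
  finDim⇒supportedBelow (ws , _ , Z⊆span) =
    maxBound ws , λ v v∈Z →
      span-least (vanishOn-isSubspace _) (λ _ → ∈⇒supportedBelow-maxBound) v (Z⊆span v v∈Z)

  subtract-add-multiple : ∀ w c z → ((w +E ((- c) ·E z)) +E (c ·E z)) ≈E w
  subtract-add-multiple w c z n = begin
    (coeff w n + - c * coeff z n) + c * coeff z n   ≈⟨ +-assoc _ _ _ ⟩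
    coeff w n + (- c * coeff z n + c * coeff z n)   ≈⟨ +-congˡ (sym (distribʳ _ _ _)) ⟩
    coeff w n + (- c + c) * coeff z n               ≈⟨ +-congˡ (*-congʳ (-‿inverseˡ c)) ⟩
    coeff w n + 0# * coeff z n                      ≈⟨ +-congˡ (zeroˡ _) ⟩
    coeff w n + 0#                                  ≈⟨ +-identityʳ _ ⟩
    coeff w n                                       ∎

  vanishesAt-subtract-multiple : ∀ w c z → c * coeff z s ≈ coeff w s →
                                 VanishesAt s (w +E ((- c) ·E z))
  vanishesAt-subtract-multiple {s} w c z czₛ≈wₛ _ ≡.refl = begin
    coeff w s + - c * coeff z s     ≈⟨ +-congˡ (sym (-‿distribˡ-* c _)) ⟩
    coeff w s + - (c * coeff z s)   ≈⟨ +-congˡ (-‿cong czₛ≈wₛ) ⟩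
    coeff w s + - coeff w s         ≈⟨ -‿inverseʳ _ ⟩
    0#                              ∎

  finDim-extend : IsSubspace Z → Z z → ¬ VanishesAt s z → FinDim (Z ∩ VanishesAt s) → FinDim Z
  finDim-extend {Z} {z} {s} S z∈Z z∉ (ws , ws⊆ , spans) =
    z ∷ ws , z∈Z ∷ All.map proj₁ ws⊆ , spans-Z
    where
      zₛ⁻¹ : ∃ λ y → coeff z s * y ≈ 1#
      zₛ⁻¹ = inverse (coeff z s) (λ zₛ≈0 → z∉ λ { _ ≡.refl → zₛ≈0 })
      spans-Z : Z ⊆ ⟨ _∈ z ∷ ws ⟩
      spans-Z w w∈Z = ≈E-resp span {w′ +E (c ·E z)} {w} (subtract-add-multiple w c z)
          (+E-closed span {w′} {c ·E z} (span-mono (λ _ → there) w′ (spans w′ (w′∈Z , w′ₛ≈0)))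
                          (·E-closed span c {z} (⊆-span z (here ≡.refl))))
        where
          span : IsSubspace ⟨ _∈ z ∷ ws ⟩
          span = span-isSubspace _
          c : Carrier
          c = coeff w s * proj₁ zₛ⁻¹
          w′ : E
          w′ = w +E ((- c) ·E z)
          w′∈Z : Z w′
          w′∈Z = +E-closed S w∈Z (·E-closed S (- c) z∈Z)
          w′ₛ≈0 : VanishesAt s w′
          w′ₛ≈0 = vanishesAt-subtract-multiple w c z (begin
            coeff w s * proj₁ zₛ⁻¹ * coeff z s     ≈⟨ *-assoc _ _ _ ⟩
            coeff w s * (proj₁ zₛ⁻¹ * coeff z s)   ≈⟨ *-congˡ (trans (*-comm _ _) (proj₂ zₛ⁻¹)) ⟩
            coeff w s * 1#                         ≈⟨ *-identityʳ _ ⟩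
            coeff w s                              ∎)

  TailMeetsTrivially : Seq → (E → Set) → Set
  TailMeetsTrivially A Z = ∃ λ N → (⟨ A / N ⟩ˢ ∩ Z) ⊆ Zero

  Separates : ℕ → Seq → ℕ → Set
  Separates t A M = (∀ i → i < M → SupportedBelow t (A i)) × (∀ i → SupportedFrom t ((A / M) i))

  span⊆tail-span+supportedBelow : ∀ A → Separates t A M → ⟨ A ⟩ˢ ⊆ (⟨ A / M ⟩ˢ +ˢ SupportedBelow t)
  span⊆tail-span+supportedBelow {t} {M} A (head , _) =
    span-least (+ˢ-isSubspace (span-isSubspace _) (vanishOn-isSubspace _)) split-term
    where
      split-term : Terms A ⊆ (⟨ A / M ⟩ˢ +ˢ SupportedBelow t)
      split-term _ (i , ≡.refl) with i <? M
      ... | yes i<M = 0E , A i , 0E∈ (span-isSubspace _) , head i i<M , λ _ → sym (+-identityˡ _)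
      ... | no  i≮M = A i , 0E , ⊆-span (A i) (i ∸ M , ≡.cong A (≡.sym (ℕₚ.m+[n∸m]≡n (ℕₚ.≮⇒≥ i≮M))))
                          , (λ _ _ → refl) , λ _ → sym (+-identityʳ _)

  span∩supportedFrom⊆tail-span : ∀ A → Separates t A M → (⟨ A ⟩ˢ ∩ SupportedFrom t) ⊆ ⟨ A / M ⟩ˢ
  span∩supportedFrom⊆tail-span {t} A sep@(_ , tail) x (x∈span , x-from)
    with span⊆tail-span+supportedBelow A sep x x∈span
  ... | y , d , y∈tail , d-below , x≈y+d = ≈E-resp (span-isSubspace _) {y} {x} y≈x y∈tail
    where
      y-from : SupportedFrom t y
      y-from = span-least (vanishOn-isSubspace _) (λ { _ (i , ≡.refl) → tail i }) y y∈tail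
      y≈x : y ≈E x
      y≈x n with n <? t
      ... | yes n<t = trans (y-from n n<t) (sym (x-from n n<t))
      ... | no  n≮t =
        sym (trans (x≈y+d n) (trans (+-congˡ (d-below n (ℕₚ.≮⇒≥ n≮t))) (+-identityʳ _)))

  blockSeq-of-supports : ∀ C (T : ℕ → ℕ) → (∀ k → T k ≤ T (suc k)) → (∀ k → NonZero (C k)) →
                         (∀ k → SupportedFrom (T k) (C k)) →
                         (∀ k → SupportedBelow (T (suc k)) (C k)) →
                         BlockSeq C
  blockSeq-of-supports C T step nonZero from below = nonZero , λ i j i<j →
    separated⇒<ᵇ (C i) (C j) (below i)
      (vanishOn-anti (λ n<T → ℕₚ.<-≤-trans n<T (stepwise-mono T step (ℕₚ.≤⇒≤′ i<j))) (C j) (from j))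

  module _ (em : ExcludedMiddle 0ℓ) where

    private
      ¬¬-elim : {P : Set} → ¬ ¬ P → P
      ¬¬-elim = em⇒dne em

    <ᵇ⇒separated : ∀ x y → x <ᵇ y → ∃ λ m → SupportedBelow m x × SupportedFrom m y
    <ᵇ⇒separated _ _ (m , x-below , y-from) =
      m , (λ n m≤n → ¬¬-elim λ xₙ≉0 → ℕₚ.<⇒≱ (x-below n xₙ≉0) m≤n)
        , (λ n n<m → ¬¬-elim λ yₙ≉0 → ℕₚ.<⇒≱ n<m (y-from n yₙ≉0))

    blockSeq-separated : ∀ A → BlockSeq A → ∀ {i j} → i < j →
                         ∃ λ m → SupportedBelow m (A i) × SupportedFrom m (A j)
    blockSeq-separated A (_ , ordered) {i} {j} i<j = <ᵇ⇒separated (A i) (A j) (ordered i j i<j)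

    blockSeq-supportedFrom-index : ∀ A → BlockSeq A → ∀ k → SupportedFrom k (A k)
    blockSeq-supportedFrom-index A blockA zero _ ()
    blockSeq-supportedFrom-index A blockA@(nonZero , _) (suc k)
      with blockSeq-separated A blockA (ℕₚ.n<1+n k)
    ... | m , Aₖ-below , Aₖ₊₁-from =
      vanishOn-anti (λ n<1+k → ℕₚ.<-≤-trans n<1+k k<m) (A (suc k)) Aₖ₊₁-from
      where
        k<m : k < m
        k<m = nonZero-supports⇒< (A k) (nonZero k)
                (blockSeq-supportedFrom-index A blockA k) Aₖ-below

    tail-span-supportedFrom : ∀ A → BlockSeq A → ∀ M → ⟨ A / M ⟩ˢ ⊆ SupportedFrom M
    tail-span-supportedFrom A blockA M = span-least (vanishOn-isSubspace _) λ { _ (i , ≡.refl) →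
      vanishOn-anti (λ n<M → ℕₚ.<-≤-trans n<M (ℕₚ.m≤m+n M i)) (A (M ℕ.+ i))
        (blockSeq-supportedFrom-index A blockA (M ℕ.+ i)) }

    blockSeq-separates : ∀ A → BlockSeq A → ∀ M → ∃ λ t → Separates t A M
    blockSeq-separates A blockA zero = 0 , (λ _ ()) , (λ _ _ ())
    blockSeq-separates A blockA@(nonZero , _) (suc M)
      with blockSeq-separated A blockA (ℕₚ.n<1+n M)
    ... | t , Aₘ-below , Aₘ₊₁-from = t , head , tail
      where
        head : ∀ i → i < suc M → SupportedBelow t (A i)
        head i i<1+M with ℕₚ.m<1+n⇒m<n∨m≡n i<1+M
        ... | inj₂ ≡.refl = Aₘ-below
        ... | inj₁ i<M with blockSeq-separated A blockA i<M
        ...   | t′ , Aᵢ-below , Aₘ-from = vanishOn-anti (ℕₚ.≤-trans t′≤t) (A i) Aᵢ-below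
          where
            t′≤t : t′ ≤ t
            t′≤t = ℕₚ.<⇒≤ (nonZero-supports⇒< (A M) (nonZero M) Aₘ-from Aₘ-below)
        tail : ∀ i → SupportedFrom t (A (suc M ℕ.+ i))
        tail zero = ≡.subst (λ k → SupportedFrom t (A k)) (≡.sym (ℕₚ.+-identityʳ (suc M))) Aₘ₊₁-from
        tail (suc i) with blockSeq-separated A blockA (ℕₚ.m<m+n (suc M) ℕ.z<s)
        ... | t′ , Aₘ₊₁-below , Aₖ-from =
          vanishOn-anti (λ n<t → ℕₚ.<-trans n<t t<t′) (A (suc M ℕ.+ suc i)) Aₖ-from
          where
            t<t′ : t < t′
            t<t′ = nonZero-supports⇒< (A (suc M)) (nonZero (suc M)) Aₘ₊₁-from Aₘ₊₁-below

    finDim-of-trivial-from : IsSubspace Z → ∀ s → (Z ∩ SupportedFrom s) ⊆ Zero → FinDim Z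
    finDim-of-trivial-from S zero triv = [] , [] , λ w w∈Z → [] , [] , triv w (w∈Z , λ _ ())
    finDim-of-trivial-from {Z} S (suc s) triv with em {∃ λ z → Z z × ¬ VanishesAt s z}
    ... | yes (z , z∈Z , z∉) = finDim-extend S z∈Z z∉
          (finDim-of-trivial-from (∩-isSubspace S (vanishOn-isSubspace _)) s
            λ w ((w∈Z , wₛ≈0) , w-from) → triv w (w∈Z , supportedFrom-suc w w-from wₛ≈0))
    ... | no ∄z = finDim-of-trivial-from S s λ w (w∈Z , w-from) →
          triv w (w∈Z , supportedFrom-suc w w-from (¬¬-elim λ w∉ → ∄z (w , w∈Z , w∉)))

    tail-trivial⇒supportedFrom-trivial : ∀ A → BlockSeq A → (⟨ A / M ⟩ˢ ∩ Z) ⊆ Zero →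
                                         ∃ λ t → ((⟨ A ⟩ˢ ∩ Z) ∩ SupportedFrom t) ⊆ Zero
    tail-trivial⇒supportedFrom-trivial {M} A blockA triv with blockSeq-separates A blockA M
    ... | t , sep = t , λ v ((v∈A , v∈Z) , v-from) →
      triv v (span∩supportedFrom⊆tail-span A sep v (v∈A , v-from) , v∈Z)

    nonZero-tails⇒big : ∀ A → BlockSeq A → IsSubspace Z →
                        (∀ M → ∃ λ v → (⟨ A / M ⟩ˢ ∩ Z) v × NonZero v) → Big (⟨ A ⟩ˢ ∩ Z)
    nonZero-tails⇒big {Z} A blockA S pick =
      C , blockC , span-least (∩-isSubspace (span-isSubspace _) S) C⊆
      where
        -- T (suc k) lies beyond the support of C k, and C (suc k) is picked from ⟨A / T (suc k)⟩.
        T : ℕ → ℕ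
        T zero    = 0
        T (suc k) = T k ⊔ bound (proj₁ (pick (T k)))
        C : Seq
        C k = proj₁ (pick (T k))
        C∈ : ∀ k → (⟨ A / T k ⟩ˢ ∩ Z) (C k)
        C∈ k = proj₁ (proj₂ (pick (T k)))
        blockC : BlockSeq C
        blockC = blockSeq-of-supports C T (λ _ → ℕₚ.m≤m⊔n _ _) (λ k → proj₂ (proj₂ (pick (T k))))
          (λ k → tail-span-supportedFrom A blockA (T k) (C k) (proj₁ (C∈ k)))
          (λ k → vanishOn-anti (ℕₚ.≤-trans (ℕₚ.m≤n⊔m (T k) _)) (C k) (vanish (C k)))
        C⊆ : Terms C ⊆ (⟨ A ⟩ˢ ∩ Z)
        C⊆ _ (k , ≡.refl) = tail-span⊆span A (T k) (C k) (proj₁ (C∈ k)) , proj₂ (C∈ k)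

    small⇔tail-trivial : ∀ A → BlockSeq A → IsSubspace Z →
                         Small (⟨ A ⟩ˢ ∩ Z) ⇔ TailMeetsTrivially A Z
    small⇔tail-trivial {Z} A blockA S = mk⇔ small⇒tail-trivial tail-trivial⇒small
      where
        nonZero-tails : ¬ TailMeetsTrivially A Z → ∀ M → ∃ λ v → (⟨ A / M ⟩ˢ ∩ Z) v × NonZero v
        nonZero-tails ¬triv M = ¬¬-elim λ ∄v →
          ¬triv (M , λ v v∈ → ¬¬-elim λ v≉0 → ∄v (v , v∈ , v≉0))
        small⇒tail-trivial : Small (⟨ A ⟩ˢ ∩ Z) → TailMeetsTrivially A Z
        small⇒tail-trivial small =
          ¬¬-elim λ ¬triv → small (nonZero-tails⇒big A blockA S (nonZero-tails ¬triv))
        tail-trivial⇒small : TailMeetsTrivially A Z → Small (⟨ A ⟩ˢ ∩ Z)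
        tail-trivial⇒small (_ , triv) (C , blockC , C⊆)
          with tail-trivial⇒supportedFrom-trivial A blockA triv
        ... | t , triv′ = proj₁ blockC t (triv′ (C t)
          (C⊆ (C t) (⊆-span (C t) (t , ≡.refl)) , blockSeq-supportedFrom-index C blockC t))

    finDim⇒tail-trivial : ∀ A → BlockSeq A → FinDim (⟨ A ⟩ˢ ∩ Z) → TailMeetsTrivially A Z
    finDim⇒tail-trivial A blockA fd with finDim⇒supportedBelow fd
    ... | b , below = b , λ v (v∈tail , v∈Z) → supportedBelow∩supportedFrom⊆zero v
      (below v (tail-span⊆span A b v v∈tail , v∈Z) , tail-span-supportedFrom A blockA b v v∈tail)

    tail-trivial⇒finDim : ∀ A → BlockSeq A → IsSubspace Z →
                          TailMeetsTrivially A Z → FinDim (⟨ A ⟩ˢ ∩ Z)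
    tail-trivial⇒finDim A blockA S (_ , triv) with tail-trivial⇒supportedFrom-trivial A blockA triv
    ... | t , triv′ = finDim-of-trivial-from (∩-isSubspace (span-isSubspace _) S) t triv′

    almostDisjoint-from-tail : ∀ A B → BlockSeq A →
                               (∃ λ N → AlmostDisjoint (A / N) B) → AlmostDisjoint A B
    almostDisjoint-from-tail A B blockA (N , ad)
      with finDim⇒tail-trivial (A / N) (blockSeq-tail A N blockA) ad
    ... | K , triv = tail-trivial⇒finDim A blockA (span-isSubspace (Terms B))
      (N ℕ.+ K , λ v (v∈tail , v∈B) → triv v (tail-span⊆tail-tail-span A N K v v∈tail , v∈B))

lemma4p9 : (F : Field) → Countable F → ExcludedMiddle 0ℓ →
    let open VS F in
    (∀ (A : Seq) (Y : E → Set) → BlockSeq A →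
       (Small (⟨ A ⟩ˢ ∩ ⟨ Y ⟩) ⇔ ∃ λ N → (⟨ A / N ⟩ˢ ∩ ⟨ Y ⟩) ⊆ Zero))
    × (∀ (A B : Seq) → BlockSeq A → BlockSeq B →
       (AlmostDisjoint A B ⇔ ∃ λ N → (⟨ A / N ⟩ˢ ∩ ⟨ B ⟩ˢ) ⊆ Zero))
    × (∀ (A B : Seq) → BlockSeq A → BlockSeq B →
       (∃ λ N → AlmostDisjoint (A / N) B) → AlmostDisjoint A B)
lemma4p9 F _ em =
  (λ A Y blockA → small⇔tail-trivial em A blockA (span-isSubspace Y)) ,
  (λ A B blockA _ → mk⇔ (finDim⇒tail-trivial em A blockA)
                        (tail-trivial⇒finDim em A blockA (span-isSubspace _))) ,
  (λ A B blockA _ → almostDisjoint-from-tail em A B blockA)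
  where open BlockSequences F
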